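{- Let $a,b\geq3$ be odd integers and $n$ an integer with $n\equiv6\pmod8$. Then $I_2=\{1/2\}$.
   Context: $\mathfrak X=\operatorname{Spec}\mathbb{Z}[X,Y,Z]/(X^2+Y^2+Z^{ab}-n^a)$; $\mathfrak X(\mathbb{Z}_2)$ is the set of solutions in $\mathbb{Z}_2^3$. For $u\in\mathbb{Q}_2^\times$, $(u,-1)_2=1$ if $u$ is a sum of two squares in $\mathbb{Q}_2$, else $-1$. Let $g(Z)=\sum_{i=0}^{a-1}n^{a-1-i}Z^{ib}$. $A$ is the Azumaya algebra on $\mathfrak X_\mathbb{Q}$ given by the quaternion algebra $(n-Z^b,-1)$ on $D(n-Z^b)$ and $(g(Z),-1)$ on $D(g(Z))$, glued via $i\mapsto(Xi'+Yi'j')/g(Z)$, $j\mapsto j'$; for $P=(x,y,z)\in\mathfrak X(\mathbb{Q}_2)$, $\operatorname{inv}_2A(P)\in\{0,1/2\}$ is $0$ iff $(n-z^b,-1)_2=1$ when $n\neq z^b$, and $0$ iff $(g(z),-1)_2=1$ when $g(z)\neq0$. $I_2=\{\operatorname{inv}_2A(P)\mid P\in\mathfrak X(\mathbb{Z}_2)\}$. -}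

module Defs where

open import Data.Nat as ℕ using (ℕ; suc)
open import Data.Integer using (ℤ; +_; _+_; _-_; _*_; _^_)
open import Data.Integer.Divisibility using (_∣_)
open import Data.List using (List; map; foldr; upTo)
open import Data.Product using (Σ; ∃; ∃-syntax; _×_)
open import Relation.Nullary using (¬_)

_≡_[mod_] : ℤ → ℤ → ℕ → Set
x ≡ y [mod m ] = (+ m) ∣ (x - y)

-- 2-adic integers, represented as coherent sequences of integer
-- representatives: x (k+1) ≡ x k (mod 2^k)  (inverse limit of ℤ/2^k).
record ℤ₂ : Set where
  constructor mkℤ₂
  field
    seq : ℕ → ℤ
    coh : ∀ k → seq (suc k) ≡ seq k [mod 2 ℕ.^ k ]
open ℤ₂ public

_≈₂_ : (ℕ → ℤ) → (ℕ → ℤ) → Set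
u ≈₂ v = ∀ k → u k ≡ v k [mod 2 ℕ.^ k ]

0₂ : ℕ → ℤ
0₂ _ = + 0

-- A nonzero element u of ℤ₂ ⊂ ℚ₂ is a sum of two squares in ℚ₂.
-- (s,t ∈ ℚ₂ with u = s² + t²; clearing denominators: 4^m u = s'² + t'²
--  with s', t' ∈ ℤ₂.)
SumOfTwoSquaresℚ₂ : (ℕ → ℤ) → Set
SumOfTwoSquaresℚ₂ u =
  ∃[ m ] Σ ℤ₂ λ s → Σ ℤ₂ λ t →
    (λ k → (+ 4) ^ m * u k) ≈₂ (λ k → seq s k ^ 2 + seq t k ^ 2)

record Point (a b : ℕ) (n : ℤ) : Set where
  constructor mkPoint
  field
    X Y Z : ℤ₂
    onX : (λ k → seq X k ^ 2 + seq Y k ^ 2 + seq Z k ^ (a ℕ.* b))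
          ≈₂ (λ k → n ^ a)
open Point public

g : (a b : ℕ) (n : ℤ) → ℤ → ℤ
g a b n z = foldr _+_ (+ 0) (map (λ i → n ^ (a ℕ.∸ 1 ℕ.∸ i) * z ^ (i ℕ.* b)) (upTo a))

data InvValue : Set where
  inv0 inv½ : InvValue

-- The Hilbert symbol value (u,-1)₂ = 1 ("u is a sum of two squares") or
-- -1; an invariant value v corresponds to "symbol = 1" iff v = 0.
SymbolMatches : InvValue → (ℕ → ℤ) → Set
SymbolMatches inv0 u = SumOfTwoSquaresℚ₂ u
SymbolMatches inv½ u = ¬ SumOfTwoSquaresℚ₂ u

-- inv₂ A(P) = v, read off from whichever chart(s) contain P.
InvA : ∀ {a b n} → Point a b n → InvValue → Set
InvA {a} {b} {n} P v =
  (¬ (u₁ ≈₂ 0₂) → SymbolMatches v u₁) × (¬ (u₂ ≈₂ 0₂) → SymbolMatches v u₂)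
  where
  u₁ : ℕ → ℤ
  u₁ k = n - seq (Z P) k ^ b
  u₂ : ℕ → ℤ
  u₂ k = g a b n (seq (Z P) k)

_∈I₂[_,_,_] : InvValue → ℕ → ℕ → ℤ → Set
v ∈I₂[ a , b , n ] = Σ (Point a b n) λ P → InvA P v

module Submission where

-- Everything rests on one 2-adic obstruction: if c ≡ 3 (mod 4) or
-- c ≡ 6 (mod 8), no 4^m c is a sum of two squares modulo 2^(2m+3) (descent
-- on m, since two squares summing to 0 mod 4 are both even).  So a chart
-- function with such residues is nonzero and not a sum of two squares in
-- ℚ₂, and it forces the invariant 1/2.  After a toolkit of congruences and
-- of squares modulo powers of 2, the file proves the obstruction, then:
--   * no point has invariant 0: the Z-coordinate has a constant parity, and
--     n - Z^b ≡ 6 (mod 8) for even Z, while g(Z) ≡ 3 (mod 4) for odd Z by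
--     Horner's rule g_{a+1} = n^a + Z^b g_a;
--   * (√(n^a + 1), 0, -1) is a point (Hensel lifting of a square root of a
--     number ≡ 1 mod 8) at which n + 1 and g(-1) are ≡ 3 (mod 4).

open import Defs
open import Data.Nat using (ℕ; _≥_)
open import Data.Integer using (ℤ; +_)
open import Data.Product using (_×_)
open import Relation.Binary.PropositionalEquality using (_≡_)
open import Function.Bundles using (_⇔_)

import Data.Nat as Nat
open Nat using (zero; suc; s≤s)
import Data.Nat.Properties as ℕₚ
import Data.Nat.Divisibility as ℕᵈ
open import Data.Integer using (_+_; _-_; _*_; -_; _^_; -1ℤ; ∣_∣)
import Data.Integer.Properties as ℤₚ
open import Data.Integer.Divisibility.Signed using (divides; ∣ᵤ⇒∣; ∣⇒∣ᵤ)
  renaming (_∣_ to _∣ₛ_)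
import Data.Integer.Divisibility.Signed as ℤᵈ
open import Data.Integer.DivMod using (_%ℕ_; _/ℕ_; n%ℕd<d; a≡a%ℕn+[a/ℕn]*n)
open import Data.Integer.Tactic.RingSolver using (solve-∀)
open import Data.List using (List; []; _∷_; map; foldr; upTo; applyUpTo)
open import Data.List.Properties using (map-cong; map-upTo; map-applyUpTo)
open import Data.Product using (Σ; ∃; _,_; proj₁; proj₂)
open import Data.Sum using (_⊎_; inj₁; inj₂)
import Data.Sum as Sum
open import Data.Empty using (⊥; ⊥-elim)
open import Relation.Nullary using (¬_)
open import Relation.Nullary.Decidable using (True; False; toWitness; toWitnessFalse)
open import Level using (0ℓ)
open import Relation.Binary.Bundles using (Setoid)
import Relation.Binary.Reasoning.Setoid as SetoidReasoning
open import Relation.Binary.PropositionalEquality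
  using (refl; sym; trans; cong; cong₂; subst; module ≡-Reasoning)
open import Function.Base using (_∘_)
open import Function.Bundles using (mk⇔)

-- Congruence modulo a natural number.  It wraps x ≡ y [mod m] of Defs in a
-- record so that both sides can be recovered by unification.
infix 4 _≡_⟨mod_⟩
record _≡_⟨mod_⟩ (x y : ℤ) (m : ℕ) : Set where
  constructor mod⟨_⟩
  field unmod : x ≡ y [mod m ]
open _≡_⟨mod_⟩ public

private
  toSigned : ∀ {x y m} → x ≡ y ⟨mod m ⟩ → + m ∣ₛ x - y
  toSigned = ∣ᵤ⇒∣ ∘ unmod

  fromSigned : ∀ {x y m} → + m ∣ₛ x - y → x ≡ y ⟨mod m ⟩
  fromSigned d = mod⟨ ∣⇒∣ᵤ d ⟩

  along : ∀ {k i j} → i ≡ j → k ∣ₛ i → k ∣ₛ j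
  along {k} = subst (k ∣ₛ_)

byQuotient : ∀ {x r m} q → x ≡ q * + m + r → x ≡ r ⟨mod m ⟩
byQuotient {x} {r} {m} q eq = fromSigned (divides q (begin
  x - r             ≡⟨ cong (_- r) eq ⟩
  (q * + m + r) - r ≡⟨ cancel (q * + m) r ⟩
  q * + m           ∎))
  where
  open ≡-Reasoning
  cancel : ∀ a r → (a + r) - r ≡ a
  cancel = solve-∀

quotient : ∀ {x r m} → x ≡ r ⟨mod m ⟩ → ∃ λ q → x ≡ q * + m + r
quotient {x} {r} h with toSigned h
... | divides q eq = q , trans (split x r) (cong (_+ r) eq)
  where
  split : ∀ x r → x ≡ (x - r) + r
  split = solve-∀

≡⇒mod : ∀ {x y m} → x ≡ y → x ≡ y ⟨mod m ⟩
≡⇒mod {x} {m = m} refl = byQuotient (+ 0) (sym (ℤₚ.+-identityˡ x))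

mod-refl : ∀ {m} x → x ≡ x ⟨mod m ⟩
mod-refl x = ≡⇒mod refl

mod-sym : ∀ {x y m} → x ≡ y ⟨mod m ⟩ → y ≡ x ⟨mod m ⟩
mod-sym {x} {y} h = fromSigned (along (flip x y) (ℤᵈ.∣m⇒∣-m (toSigned h)))
  where
  flip : ∀ x y → - (x - y) ≡ y - x
  flip = solve-∀

mod-trans : ∀ {x y z m} → x ≡ y ⟨mod m ⟩ → y ≡ z ⟨mod m ⟩ → x ≡ z ⟨mod m ⟩
mod-trans {x} {y} {z} h h' =
  fromSigned (along (telescope x y z) (ℤᵈ.∣m∣n⇒∣m+n (toSigned h) (toSigned h')))
  where
  telescope : ∀ x y z → (x - y) + (y - z) ≡ x - z
  telescope = solve-∀

mod-+ : ∀ {x y x' y' m} → x ≡ y ⟨mod m ⟩ → x' ≡ y' ⟨mod m ⟩ → x + x' ≡ y + y' ⟨mod m ⟩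
mod-+ {x} {y} {x'} {y'} h h' =
  fromSigned (along (regroup x y x' y') (ℤᵈ.∣m∣n⇒∣m+n (toSigned h) (toSigned h')))
  where
  regroup : ∀ x y x' y' → (x - y) + (x' - y') ≡ (x + x') - (y + y')
  regroup = solve-∀

mod-- : ∀ {x y x' y' m} → x ≡ y ⟨mod m ⟩ → x' ≡ y' ⟨mod m ⟩ → x - x' ≡ y - y' ⟨mod m ⟩
mod-- {x} {y} {x'} {y'} h h' =
  fromSigned (along (regroup x y x' y') (ℤᵈ.∣m∣n⇒∣m-n (toSigned h) (toSigned h')))
  where
  regroup : ∀ x y x' y' → (x - y) - (x' - y') ≡ (x - x') - (y - y')
  regroup = solve-∀

mod-* : ∀ {x y x' y' m} → x ≡ y ⟨mod m ⟩ → x' ≡ y' ⟨mod m ⟩ → x * x' ≡ y * y' ⟨mod m ⟩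
mod-* {x} {y} {x'} {y'} h h' = fromSigned (along (regroup x y x' y')
  (ℤᵈ.∣m∣n⇒∣m+n (ℤᵈ.∣n⇒∣m*n x (toSigned h')) (ℤᵈ.∣m⇒∣m*n y' (toSigned h))))
  where
  regroup : ∀ x y x' y' → x * (x' - y') + (x - y) * y' ≡ x * x' - y * y'
  regroup = solve-∀

mod-weaken : ∀ {x y d m} → d ℕᵈ.∣ m → x ≡ y ⟨mod m ⟩ → x ≡ y ⟨mod d ⟩
mod-weaken d∣m h = mod⟨ ℕᵈ.∣-trans d∣m (unmod h) ⟩

mod-cancel : ∀ k .{{_ : Nat.NonZero k}} {x y m} →
             + k * x ≡ + k * y ⟨mod k Nat.* m ⟩ → x ≡ y ⟨mod m ⟩
mod-cancel k {x} {y} h = mod⟨ ℕᵈ.*-cancelˡ-∣ k (subst (_ ℕᵈ.∣_) ∣k[x-y]∣ (unmod h)) ⟩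
  where
  ∣k[x-y]∣ : ∣ + k * x - + k * y ∣ ≡ k Nat.* ∣ x - y ∣
  ∣k[x-y]∣ = trans (cong ∣_∣ (factor (+ k) x y)) (ℤₚ.abs-* (+ k) (x - y))
    where
    factor : ∀ k x y → k * x - k * y ≡ k * (x - y)
    factor = solve-∀

2∣4 : 2 ℕᵈ.∣ 4
2∣4 = ℕᵈ.divides 2 refl
4∣8 : 4 ℕᵈ.∣ 8
4∣8 = ℕᵈ.divides 2 refl

decide : ∀ {x y m} {_ : True (m ℕᵈ.∣? ∣ x - y ∣)} → x ≡ y ⟨mod m ⟩
decide {_} {_} {m} {t} = mod⟨ toWitness t ⟩

clash : ∀ {x r s m} → x ≡ r ⟨mod m ⟩ → x ≡ s ⟨mod m ⟩ →
        {_ : False (m ℕᵈ.∣? ∣ r - s ∣)} → ⊥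
clash h h' {f} = toWitnessFalse f (unmod (mod-trans (mod-sym h) h'))

mod-resp : ∀ {x x' y y' m m'} → x ≡ x' → y ≡ y' → m ≡ m' → x ≡ y ⟨mod m ⟩ → x' ≡ y' ⟨mod m' ⟩
mod-resp refl refl refl h = h

mod-^ : ∀ {x y m} → x ≡ y ⟨mod m ⟩ → ∀ e → x ^ e ≡ y ^ e ⟨mod m ⟩
mod-^ h zero    = mod-refl _
mod-^ h (suc e) = mod-* h (mod-^ h e)

modSetoid : ℕ → Setoid 0ℓ 0ℓ
modSetoid m = record
  { Carrier       = ℤ
  ; _≈_           = λ x y → x ≡ y ⟨mod m ⟩
  ; isEquivalence = record { refl = mod-refl _ ; sym = mod-sym ; trans = mod-trans }
  }

module ModReasoning (m : ℕ) = SetoidReasoning (modSetoid m)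

parity : ∀ x → x ≡ + 0 ⟨mod 2 ⟩ ⊎ x ≡ + 1 ⟨mod 2 ⟩
parity x with x %ℕ 2 | n%ℕd<d x 2 | a≡a%ℕn+[a/ℕn]*n x 2
... | 0 | _ | eq = inj₁ (byQuotient (x /ℕ 2) (trans eq (ℤₚ.+-comm (+ 0) (x /ℕ 2 * + 2))))
... | 1 | _ | eq = inj₂ (byQuotient (x /ℕ 2) (trans eq (ℤₚ.+-comm (+ 1) (x /ℕ 2 * + 2))))
... | suc (suc _) | s≤s (s≤s ()) | _

evenOrOdd : ∀ x → (∃ λ h → x ≡ h * + 2 + + 0) ⊎ (∃ λ h → x ≡ h * + 2 + + 1)
evenOrOdd x = Sum.map quotient quotient (parity x)

-- The ring solver works with products, so squares are unfolded first.
square : ∀ x → x ^ 2 ≡ x * x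
square x = cong (x *_) (ℤₚ.*-identityʳ x)

odd-square : ∀ {x} → x ≡ + 1 ⟨mod 2 ⟩ → x ^ 2 ≡ + 1 ⟨mod 8 ⟩
odd-square h with quotient h
... | q , refl with evenOrOdd q
...   | inj₁ (p , refl) = byQuotient (+ 2 * p * p + p) (trans (square ((p * + 2 + + 0) * + 2 + + 1)) (expand p))
  where
  expand : ∀ t → let x = (t * + 2 + + 0) * + 2 + + 1 in x * x ≡ (+ 2 * t * t + t) * + 8 + + 1
  expand = solve-∀
...   | inj₂ (p , refl) = byQuotient (+ 2 * p * p + + 3 * p + + 1)
                            (trans (square ((p * + 2 + + 1) * + 2 + + 1)) (expand p))
  where
  expand : ∀ t → let x = (t * + 2 + + 1) * + 2 + + 1 in x * x ≡ (+ 2 * t * t + + 3 * t + + 1) * + 8 + + 1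
  expand = solve-∀

even-square : ∀ {x} → x ≡ + 0 ⟨mod 2 ⟩ → x ^ 2 ≡ + 0 ⟨mod 4 ⟩
even-square h with quotient h
... | q , refl = byQuotient (q * q) (trans (square (q * + 2 + + 0)) (expand q))
  where
  expand : ∀ t → (t * + 2 + + 0) * (t * + 2 + + 0) ≡ (t * t) * + 4 + + 0
  expand = solve-∀

even-power : ∀ {x} → x ≡ + 0 ⟨mod 2 ⟩ → ∀ e → x ^ (3 Nat.+ e) ≡ + 0 ⟨mod 8 ⟩
even-power {x} h e with quotient h
... | q , refl = byQuotient (q * q * q * x ^ e) (expand q (x ^ e))
  where
  expand : ∀ t w → (t * + 2 + + 0) * ((t * + 2 + + 0) * ((t * + 2 + + 0) * w)) ≡ (t * t * t * w) * + 8 + + 0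
  expand = solve-∀

odd-power : ∀ {z} → z ≡ + 1 ⟨mod 2 ⟩ → ∀ e → z ^ e ≡ + 1 ⟨mod 2 ⟩
odd-power h e = mod-resp refl (ℤₚ.^-zeroˡ e) refl (mod-^ h e)

minusOne-odd-power : ∀ l → -1ℤ ^ suc (l Nat.* 2) ≡ -1ℤ
minusOne-odd-power zero    = refl
minusOne-odd-power (suc l) = cong (λ w → -1ℤ * (-1ℤ * w)) (minusOne-odd-power l)

odd-from-3 : ∀ {a} → a ≥ 3 → (+ a) ≡ (+ 1) [mod 2 ] → ∃ λ k → a ≡ 3 Nat.+ k Nat.* 2
odd-from-3 (s≤s (s≤s (s≤s _))) (ℕᵈ.divides (suc k) eq) =
  k , cong (3 Nat.+_) (ℕₚ.suc-injective (ℕₚ.suc-injective eq))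

parity-stable : (x : ℤ₂) → ∀ k → seq x (suc k) ≡ seq x 1 ⟨mod 2 ⟩
parity-stable x zero    = mod-refl _
parity-stable x (suc k) =
  mod-trans (mod-weaken (ℕᵈ.m∣m*n (2 Nat.^ k)) mod⟨ coh x (suc k) ⟩) (parity-stable x k)

parity₂ : (x : ℤ₂) → (∀ k → seq x (suc k) ≡ + 0 ⟨mod 2 ⟩) ⊎ (∀ k → seq x (suc k) ≡ + 1 ⟨mod 2 ⟩)
parity₂ x = Sum.map (λ h k → mod-trans (parity-stable x k) h)
                    (λ h k → mod-trans (parity-stable x k) h) (parity (seq x 1))

double-squares : ∀ p q → (p * + 2 + + 0) ^ 2 + (q * + 2 + + 0) ^ 2 ≡ + 4 * (p ^ 2 + q ^ 2)
double-squares p q = begin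
  (p * + 2 + + 0) ^ 2 + (q * + 2 + + 0) ^ 2
    ≡⟨ cong₂ _+_ (square (p * + 2 + + 0)) (square (q * + 2 + + 0)) ⟩
  (p * + 2 + + 0) * (p * + 2 + + 0) + (q * + 2 + + 0) * (q * + 2 + + 0)
    ≡⟨ expand p q ⟩
  + 4 * (p * p + q * q)
    ≡⟨ cong (+ 4 *_) (sym (cong₂ _+_ (square p) (square q))) ⟩
  + 4 * (p ^ 2 + q ^ 2) ∎
  where
  open ≡-Reasoning
  expand : ∀ p q → (p * + 2 + + 0) * (p * + 2 + + 0) + (q * + 2 + + 0) * (q * + 2 + + 0) ≡ + 4 * (p * p + q * q)
  expand = solve-∀

data SquareSum (s t : ℤ) : Set where
  both-even : ∀ p q → s ≡ p * + 2 + + 0 → t ≡ q * + 2 + + 0 → SquareSum s t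
  one-odd   : s ^ 2 + t ^ 2 ≡ + 1 ⟨mod 4 ⟩ → SquareSum s t
  both-odd  : s ^ 2 + t ^ 2 ≡ + 2 ⟨mod 8 ⟩ → SquareSum s t

squareSum : ∀ s t → SquareSum s t
squareSum s t with parity s | parity t
... | inj₁ s-even | inj₂ t-odd  = one-odd (mod-+ (even-square s-even) (mod-weaken 4∣8 (odd-square t-odd)))
... | inj₂ s-odd  | inj₁ t-even = one-odd (mod-+ (mod-weaken 4∣8 (odd-square s-odd)) (even-square t-even))
... | inj₂ s-odd  | inj₂ t-odd  = both-odd (mod-+ (odd-square s-odd) (odd-square t-odd))
... | inj₁ s-even | inj₁ t-even with quotient s-even | quotient t-even
...   | p , s≡2p | q , t≡2q = both-even p q s≡2p t≡2q

TwoSquaresResidue : ℤ → Set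
TwoSquaresResidue r = r ≡ + 0 ⟨mod 4 ⟩ ⊎ r ≡ + 1 ⟨mod 4 ⟩ ⊎ r ≡ + 2 ⟨mod 8 ⟩

multiple-of-4 : ∀ y → + 4 * y ≡ + 0 ⟨mod 4 ⟩
multiple-of-4 y = byQuotient y (trans (ℤₚ.*-comm (+ 4) y) (sym (ℤₚ.+-identityʳ (y * + 4))))

twoSquaresResidue : ∀ s t → TwoSquaresResidue (s ^ 2 + t ^ 2)
twoSquaresResidue s t with squareSum s t
... | both-even p q refl refl = inj₁ (mod-resp (sym (double-squares p q)) refl refl (multiple-of-4 _))
... | one-odd  sum≡1 = inj₂ (inj₁ sum≡1)
... | both-odd sum≡2 = inj₂ (inj₂ sum≡2)

Obstructed : ℤ → Set
Obstructed c = c ≡ + 3 ⟨mod 4 ⟩ ⊎ c ≡ + 6 ⟨mod 8 ⟩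

obstructed-mod-8 : ∀ {c r} → Obstructed c → c ≡ r ⟨mod 8 ⟩ → ¬ TwoSquaresResidue r
obstructed-mod-8 (inj₁ c≡3) c≡r (inj₁ r≡0)        = clash c≡3 (mod-trans (mod-weaken 4∣8 c≡r) r≡0)
obstructed-mod-8 (inj₁ c≡3) c≡r (inj₂ (inj₁ r≡1)) = clash c≡3 (mod-trans (mod-weaken 4∣8 c≡r) r≡1)
obstructed-mod-8 (inj₁ c≡3) c≡r (inj₂ (inj₂ r≡2)) = clash c≡3 (mod-weaken 4∣8 (mod-trans c≡r r≡2))
obstructed-mod-8 (inj₂ c≡6) c≡r (inj₁ r≡0)        =
  clash (mod-weaken 4∣8 c≡6) (mod-trans (mod-weaken 4∣8 c≡r) r≡0)
obstructed-mod-8 (inj₂ c≡6) c≡r (inj₂ (inj₁ r≡1)) =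
  clash (mod-weaken 4∣8 c≡6) (mod-trans (mod-weaken 4∣8 c≡r) r≡1)
obstructed-mod-8 (inj₂ c≡6) c≡r (inj₂ (inj₂ r≡2)) = clash c≡6 (mod-trans c≡r r≡2)

2^[2+k] : ∀ k → 2 Nat.^ (2 Nat.+ k) ≡ 4 Nat.* 2 Nat.^ k
2^[2+k] k = sym (ℕₚ.*-assoc 2 2 (2 Nat.^ k))

4∣2^[2+k] : ∀ k → 4 ℕᵈ.∣ 2 Nat.^ (2 Nat.+ k)
4∣2^[2+k] k = subst (4 ℕᵈ.∣_) (sym (2^[2+k] k)) (ℕᵈ.m∣m*n (2 Nat.^ k))

scaled-vanishes : ∀ m c {r} → (+ 4) ^ suc m * c ≡ r ⟨mod 2 Nat.^ (5 Nat.+ m Nat.* 2) ⟩ →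
                  r ≡ + 0 ⟨mod 4 ⟩
scaled-vanishes m c h = mod-trans (mod-sym (mod-weaken (4∣2^[2+k] (3 Nat.+ m Nat.* 2)) h))
  (mod-resp (sym (ℤₚ.*-assoc (+ 4) ((+ 4) ^ m) c)) refl refl (multiple-of-4 ((+ 4) ^ m * c)))

descend : ∀ m c p q →
  (+ 4) ^ suc m * c ≡ (p * + 2 + + 0) ^ 2 + (q * + 2 + + 0) ^ 2 ⟨mod 2 Nat.^ (5 Nat.+ m Nat.* 2) ⟩ →
  (+ 4) ^ m * c ≡ p ^ 2 + q ^ 2 ⟨mod 2 Nat.^ (3 Nat.+ m Nat.* 2) ⟩
descend m c p q h = mod-cancel 4
  (mod-resp (ℤₚ.*-assoc (+ 4) ((+ 4) ^ m) c) (double-squares p q) (2^[2+k] (3 Nat.+ m Nat.* 2)) h)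

-- Descent on m: modulo 4 the left side vanishes, which forces
-- both squares to be even, and then everything can be divided by 4.
obstruction : ∀ {c} → Obstructed c → ∀ m s t →
              ¬ ((+ 4) ^ m * c ≡ s ^ 2 + t ^ 2 ⟨mod 2 Nat.^ (3 Nat.+ m Nat.* 2) ⟩)
obstruction {c} obs zero s t h =
  obstructed-mod-8 obs (mod-resp (ℤₚ.*-identityˡ c) refl refl h) (twoSquaresResidue s t)
obstruction {c} obs (suc m) s t h with squareSum s t
... | both-even p q refl refl = obstruction obs m p q (descend m c p q h)
... | one-odd  sum≡1 = clash (scaled-vanishes m c h) sum≡1
... | both-odd sum≡2 = clash (scaled-vanishes m c h) (mod-weaken 4∣8 sum≡2)

ObstructedSeq : (ℕ → ℤ) → Set
ObstructedSeq u = ∀ k → Obstructed (u (suc k))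

-- 0 = 0² + 0², so an obstructed sequence is a nonzero 2-adic number.
obstructed-nonzero : ∀ {u} → ObstructedSeq u → ¬ (u ≈₂ 0₂)
obstructed-nonzero {u} obs u≈0 =
  obstruction (obs 2) 0 (+ 0) (+ 0) (mod-resp (sym (ℤₚ.*-identityˡ (u 3))) refl refl mod⟨ u≈0 3 ⟩)

-- A sum of two squares in ℚ₂ would give, after scaling by 4^m, a sum of two
-- squares modulo 2^(2m+3).
obstructed-not-sum : ∀ {u} → ObstructedSeq u → ¬ SumOfTwoSquaresℚ₂ u
obstructed-not-sum obs (m , s , t , h) =
  obstruction (obs (2 Nat.+ m Nat.* 2)) m (seq s k) (seq t k) mod⟨ h k ⟩
  where
  k : ℕ
  k = 3 Nat.+ m Nat.* 2

chart₁ : ∀ {a b n} → Point a b n → ℕ → ℤ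
chart₁ {b = b} {n} P k = n - seq (Z P) k ^ b

chart₂ : ∀ {a b n} → Point a b n → ℕ → ℤ
chart₂ {a} {b} {n} P k = g a b n (seq (Z P) k)

no-inv0 : ∀ {a b n} (P : Point a b n) →
          ObstructedSeq (chart₁ P) ⊎ ObstructedSeq (chart₂ P) → ¬ InvA P inv0
no-inv0 P (inj₁ obs) (in-chart₁ , _) = obstructed-not-sum obs (in-chart₁ (obstructed-nonzero {chart₁ P} obs))
no-inv0 P (inj₂ obs) (_ , in-chart₂) = obstructed-not-sum obs (in-chart₂ (obstructed-nonzero {chart₂ P} obs))

invariant-½ : ∀ {a b n} (P : Point a b n) →
       ObstructedSeq (chart₁ P) → ObstructedSeq (chart₂ P) → InvA P inv½
invariant-½ P obs₁ obs₂ = (λ _ → obstructed-not-sum obs₁) , (λ _ → obstructed-not-sum obs₂)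

only-½ : ∀ {a b n} → (∀ (P : Point a b n) → ¬ InvA P inv0) →
         ∀ {v} → v ∈I₂[ a , b , n ] → v ≡ inv½
only-½ none {inv0} (P , inv) = ⊥-elim (none P inv)
only-½ none {inv½} _         = refl

sumOver : (ℕ → ℤ) → List ℕ → ℤ
sumOver f xs = foldr _+_ (+ 0) (map f xs)

sumOver-scale : ∀ c f xs → sumOver (λ i → c * f i) xs ≡ c * sumOver f xs
sumOver-scale c f []       = sym (ℤₚ.*-zeroʳ c)
sumOver-scale c f (x ∷ xs) = trans (cong (_+_ (c * f x)) (sumOver-scale c f xs))
                                   (sym (ℤₚ.*-distribˡ-+ c (f x) (sumOver f xs)))

g-horner : ∀ a b n z → g (suc a) b n z ≡ n ^ a + z ^ b * g a b n z
g-horner a b n z = begin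
  g (suc a) b n z                                       ≡⟨⟩
  term 0 + foldr _+_ (+ 0) (map term (applyUpTo suc a))
    ≡⟨ cong₂ _+_ (ℤₚ.*-identityʳ (n ^ a)) (cong (foldr _+_ (+ 0)) shift) ⟩
  n ^ a + sumOver (λ j → z ^ b * summand j) (upTo a)
    ≡⟨ cong (_+_ (n ^ a)) (sumOver-scale (z ^ b) summand (upTo a)) ⟩
  n ^ a + z ^ b * g a b n z                              ∎
  where
  open ≡-Reasoning
  term summand : ℕ → ℤ
  term    i = n ^ (a Nat.∸ i) * z ^ (i Nat.* b)
  summand j = n ^ (a Nat.∸ 1 Nat.∸ j) * z ^ (j Nat.* b)
  term-suc : ∀ j → term (suc j) ≡ z ^ b * summand j
  term-suc j = trans (cong₂ _*_ (cong (n ^_) (sym (ℕₚ.∸-+-assoc a 1 j)))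
                                (ℤₚ.^-distribˡ-+-* z b (j Nat.* b)))
                     (swap (n ^ (a Nat.∸ 1 Nat.∸ j)) (z ^ b) (z ^ (j Nat.* b)))
    where
    swap : ∀ x w y → x * (w * y) ≡ w * (x * y)
    swap = solve-∀
  shift : map term (applyUpTo suc a) ≡ map (λ j → z ^ b * summand j) (upTo a)
  shift = trans (map-applyUpTo suc term a)
         (trans (sym (map-upTo (term ∘ suc) a)) (map-cong term-suc (upTo a)))

-- g_3 = n² + n w + w² with w = z^b, which is 0 + 2 + 1 modulo 4.
g₃-mod4 : ∀ {n z} b → n ≡ + 2 ⟨mod 4 ⟩ → z ≡ + 1 ⟨mod 2 ⟩ → g 3 b n z ≡ + 3 ⟨mod 4 ⟩
g₃-mod4 {n} {z} b hn hz with quotient hn | quotient (odd-power hz b)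
... | q , n≡ | v , w≡ = byQuotient (+ 4 * q * q + + 5 * q + + 2 * q * v + v * v + + 2 * v + + 1) (begin
  g 3 b n z
    ≡⟨ trans (g-horner 2 b n z) (cong (λ y → n ^ 2 + z ^ b * y)
         (trans (g-horner 1 b n z) (cong (λ y → n ^ 1 + z ^ b * y) (g-horner 0 b n z)))) ⟩
  n ^ 2 + z ^ b * (n ^ 1 + z ^ b * (n ^ 0 + z ^ b * + 0))
    ≡⟨ cong₂ horner₃ n≡ w≡ ⟩
  horner₃ (q * + 4 + + 2) (v * + 2 + + 1)
    ≡⟨ expand q v ⟩
  (+ 4 * q * q + + 5 * q + + 2 * q * v + v * v + + 2 * v + + 1) * + 4 + + 3 ∎)
  where
  open ≡-Reasoning
  horner₃ : ℤ → ℤ → ℤ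
  horner₃ n w = n ^ 2 + w * (n ^ 1 + w * (n ^ 0 + w * + 0))
  expand : ∀ q v → let n = q * + 4 + + 2 ; w = v * + 2 + + 1 in
    n * (n * + 1) + w * (n * + 1 + w * (+ 1 + w * + 0)) ≡
    (+ 4 * q * q + + 5 * q + + 2 * q * v + v * v + + 2 * v + + 1) * + 4 + + 3
  expand = solve-∀

-- For n even and z odd, g_{a+2} ≡ g_a (mod 4) when a ≥ 3: the terms
-- n^(a+1) and z^b n^a vanish and z^(2b) ≡ 1.
g-period-2 : ∀ {n z} b e → n ≡ + 0 ⟨mod 2 ⟩ → z ≡ + 1 ⟨mod 2 ⟩ →
             g (5 Nat.+ e) b n z ≡ g (3 Nat.+ e) b n z ⟨mod 4 ⟩
g-period-2 {n} {z} b e n-even z-odd = begin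
  g (5 Nat.+ e) b n z
    ≡⟨ trans (g-horner (4 Nat.+ e) b n z) (cong (λ y → n ^ (4 Nat.+ e) + w * y) (g-horner (3 Nat.+ e) b n z)) ⟩
  n ^ (4 Nat.+ e) + w * (n ^ (3 Nat.+ e) + w * G)
    ≈⟨ mod-+ (vanishes (suc e)) (mod-* (mod-refl w) (mod-+ (vanishes e) (mod-refl (w * G)))) ⟩
  + 0 + w * (+ 0 + w * G)
    ≡⟨ trans (collect w G) (cong (_* G) (sym (square w))) ⟩
  w ^ 2 * G
    ≈⟨ mod-* (mod-weaken 4∣8 (odd-square (odd-power z-odd b))) (mod-refl G) ⟩
  + 1 * G
    ≡⟨ ℤₚ.*-identityˡ G ⟩
  G ∎
  where
  open ModReasoning 4
  w G : ℤ
  w = z ^ b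
  G = g (3 Nat.+ e) b n z
  vanishes : ∀ e → n ^ (3 Nat.+ e) ≡ + 0 ⟨mod 4 ⟩
  vanishes e = mod-weaken 4∣8 (even-power n-even e)
  collect : ∀ w G → + 0 + w * (+ 0 + w * G) ≡ w * w * G
  collect = solve-∀

g-mod4 : ∀ {n z} b → n ≡ + 2 ⟨mod 4 ⟩ → z ≡ + 1 ⟨mod 2 ⟩ →
         ∀ k → g (3 Nat.+ k Nat.* 2) b n z ≡ + 3 ⟨mod 4 ⟩
g-mod4 b hn hz zero    = g₃-mod4 b hn hz
g-mod4 b hn hz (suc k) =
  mod-trans (g-period-2 b (k Nat.* 2) (mod-trans (mod-weaken 2∣4 hn) decide) hz) (g-mod4 b hn hz k)

record ApproxRoot (u : ℤ) (k : ℕ) : Set where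
  constructor approxRoot
  field
    half  : ℤ
    error : ℤ
    close : (half * + 2 + + 1) * (half * + 2 + + 1) - u ≡ error * (+ 8 * + (2 Nat.^ k))

  root : ℤ
  root = half * + 2 + + 1
open ApproxRoot

-- Hensel step: if the error is odd, adding 2^(k+2) to the root makes it even.
refine : ∀ {u k} (r : ApproxRoot u k) → Σ (ApproxRoot u (suc k)) λ r' → root r' ≡ root r ⟨mod 2 Nat.^ k ⟩
refine {u} {k} (approxRoot h e close) with evenOrOdd e
... | inj₁ (e' , refl) = approxRoot h e' close' , mod-refl _
  where
  open ≡-Reasoning
  R : ℤ
  R = + (2 Nat.^ k)
  close' : (h * + 2 + + 1) * (h * + 2 + + 1) - u ≡ e' * (+ 8 * + (2 Nat.^ suc k))
  close' = begin
    (h * + 2 + + 1) * (h * + 2 + + 1) - u ≡⟨ close ⟩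
    (e' * + 2 + + 0) * (+ 8 * R)          ≡⟨ regroup e' R ⟩
    e' * (+ 8 * (+ 2 * R))                ≡⟨ cong (λ P → e' * (+ 8 * P)) (sym (ℤₚ.pos-* 2 (2 Nat.^ k))) ⟩
    e' * (+ 8 * + (2 Nat.^ suc k))        ∎
    where
    regroup : ∀ e R → (e * + 2 + + 0) * (+ 8 * R) ≡ e * (+ 8 * (+ 2 * R))
    regroup = solve-∀
... | inj₂ (e' , refl) = approxRoot (h + + 2 * R) (e' + h + + 1 + R) close' , byQuotient (+ 4) (moved h R)
  where
  open ≡-Reasoning
  R r' : ℤ
  R  = + (2 Nat.^ k)
  r' = (h + + 2 * R) * + 2 + + 1
  close' : r' * r' - u ≡ (e' + h + + 1 + R) * (+ 8 * + (2 Nat.^ suc k))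
  close' = begin
    r' * r' - u                                                   ≡⟨ expand h R u ⟩
    ((h * + 2 + + 1) * (h * + 2 + + 1) - u) + (+ 16 * R * h + + 8 * R + + 16 * R * R)
      ≡⟨ cong (_+ (+ 16 * R * h + + 8 * R + + 16 * R * R)) close ⟩
    (e' * + 2 + + 1) * (+ 8 * R) + (+ 16 * R * h + + 8 * R + + 16 * R * R)
      ≡⟨ collect e' h R ⟩
    (e' + h + + 1 + R) * (+ 8 * (+ 2 * R))
      ≡⟨ cong (λ P → (e' + h + + 1 + R) * (+ 8 * P)) (sym (ℤₚ.pos-* 2 (2 Nat.^ k))) ⟩
    (e' + h + + 1 + R) * (+ 8 * + (2 Nat.^ suc k))                ∎
    where
    expand : ∀ h R u → ((h + + 2 * R) * + 2 + + 1) * ((h + + 2 * R) * + 2 + + 1) - u ≡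
                       ((h * + 2 + + 1) * (h * + 2 + + 1) - u) + (+ 16 * R * h + + 8 * R + + 16 * R * R)
    expand = solve-∀
    collect : ∀ e h R → (e * + 2 + + 1) * (+ 8 * R) + (+ 16 * R * h + + 8 * R + + 16 * R * R) ≡
                        (e + h + + 1 + R) * (+ 8 * (+ 2 * R))
    collect = solve-∀
  moved : ∀ h R → (h + + 2 * R) * + 2 + + 1 ≡ + 4 * R + (h * + 2 + + 1)
  moved = solve-∀

approxRoots : ∀ {u} → u ≡ + 1 ⟨mod 8 ⟩ → ∀ k → ApproxRoot u k
approxRoots h zero with quotient h
... | q , refl = approxRoot (+ 0) (- q) (start q)
  where
  start : ∀ q → (+ 0 * + 2 + + 1) * (+ 0 * + 2 + + 1) - (q * + 8 + + 1) ≡ - q * (+ 8 * + 1)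
  start = solve-∀
approxRoots h (suc k) = proj₁ (refine (approxRoots h k))

root-close : ∀ {u k} (r : ApproxRoot u k) → root r ^ 2 ≡ u ⟨mod 2 Nat.^ k ⟩
root-close {u} {k} r@(approxRoot h e close) = byQuotient (e * + 8) (begin
  root r ^ 2                ≡⟨ square (root r) ⟩
  root r * root r           ≡⟨ split (root r * root r) u ⟩
  (root r * root r - u) + u ≡⟨ cong (_+ u) close ⟩
  e * (+ 8 * R) + u         ≡⟨ cong (_+ u) (ℤₚ.*-assoc e (+ 8) R) ⟨
  e * + 8 * R + u           ∎)
  where
  open ≡-Reasoning
  R : ℤ
  R = + (2 Nat.^ k)
  split : ∀ x u → x ≡ (x - u) + u
  split = solve-∀

squareRoot : ∀ {u} → u ≡ + 1 ⟨mod 8 ⟩ → Σ ℤ₂ λ x → ∀ k → seq x k ^ 2 ≡ u ⟨mod 2 Nat.^ k ⟩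
squareRoot {u} h = mkℤ₂ (λ k → root (roots k)) (λ k → unmod (proj₂ (refine (roots k))))
             , λ k → root-close (roots k)
  where
  roots : ∀ k → ApproxRoot u k
  roots = approxRoots h

const₂ : ℤ → ℤ₂
const₂ x = mkℤ₂ (λ _ → x) (λ _ → unmod (mod-refl x))

pointAtMinusOne : ∀ {a b n} → n ^ a ≡ + 0 ⟨mod 8 ⟩ → -1ℤ ^ (a Nat.* b) ≡ -1ℤ → Point a b n
pointAtMinusOne {a} {b} {n} n^a≡0 sign = mkPoint (proj₁ √[n^a+1]) (const₂ (+ 0)) (const₂ -1ℤ) on-𝔛
  where
  √[n^a+1] : Σ ℤ₂ λ x → ∀ k → seq x k ^ 2 ≡ n ^ a + + 1 ⟨mod 2 Nat.^ k ⟩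
  √[n^a+1] = squareRoot (mod-+ n^a≡0 (mod-refl (+ 1)))
  on-𝔛 : (λ k → seq (proj₁ √[n^a+1]) k ^ 2 + (+ 0) ^ 2 + -1ℤ ^ (a Nat.* b)) ≈₂ (λ _ → n ^ a)
  on-𝔛 k = unmod (mod-resp refl (cancel (n ^ a)) refl
    (mod-+ (mod-+ (proj₂ √[n^a+1] k) (mod-refl (+ 0))) (≡⇒mod sign)))
    where
    cancel : ∀ y → y + + 1 + + 0 - + 1 ≡ y
    cancel = solve-∀

module _ {n : ℤ} (n≡6 : n ≡ + 6 ⟨mod 8 ⟩) where

  n≡2 : n ≡ + 2 ⟨mod 4 ⟩
  n≡2 = mod-trans (mod-weaken 4∣8 n≡6) decide

  n-even : n ≡ + 0 ⟨mod 2 ⟩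
  n-even = mod-trans (mod-weaken 2∣4 n≡2) decide

  -- At every point one chart is obstructed, according to the parity of Z:
  -- n - Z^b ≡ 6 (mod 8) for even Z, g(Z) ≡ 3 (mod 4) for odd Z.
  some-chart-obstructed : ∀ k l (P : Point (3 Nat.+ k Nat.* 2) (3 Nat.+ l Nat.* 2) n) →
                          ObstructedSeq (chart₁ P) ⊎ ObstructedSeq (chart₂ P)
  some-chart-obstructed k l P with parity₂ (Z P)
  ... | inj₁ Z-even = inj₁ λ j → inj₂ (mod-- n≡6 (even-power (Z-even j) (l Nat.* 2)))
  ... | inj₂ Z-odd  = inj₂ λ j → inj₁ (g-mod4 _ n≡2 (Z-odd j) k)

  -- The point (√(n^a + 1), 0, -1), where n - (-1)^b = n + 1 ≡ 3 (mod 4) and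
  -- g(-1) ≡ 3 (mod 4).
  point-½ : ∀ k l → inv½ ∈I₂[ 3 Nat.+ k Nat.* 2 , 3 Nat.+ l Nat.* 2 , n ]
  point-½ k l = P , invariant-½ P (λ _ → inj₁ n+1≡3) (λ _ → inj₁ (g-mod4 _ n≡2 decide k))
    where
    sign-b : -1ℤ ^ (3 Nat.+ l Nat.* 2) ≡ -1ℤ
    sign-b = minusOne-odd-power (suc l)
    sign-ab : -1ℤ ^ ((3 Nat.+ k Nat.* 2) Nat.* (3 Nat.+ l Nat.* 2)) ≡ -1ℤ
    sign-ab = trans (sym (ℤₚ.^-*-assoc -1ℤ (3 Nat.+ k Nat.* 2) (3 Nat.+ l Nat.* 2)))
                    (trans (cong (_^ (3 Nat.+ l Nat.* 2)) (minusOne-odd-power (suc k))) sign-b)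
    P : Point (3 Nat.+ k Nat.* 2) (3 Nat.+ l Nat.* 2) n
    P = pointAtMinusOne (even-power n-even (k Nat.* 2)) sign-ab
    n+1≡3 : n - -1ℤ ^ (3 Nat.+ l Nat.* 2) ≡ + 3 ⟨mod 4 ⟩
    n+1≡3 = mod-trans (mod-weaken 4∣8 (mod-- n≡6 (≡⇒mod sign-b))) decide

lemma3p8 : (a b : ℕ) (n : ℤ) →
    a ≥ 3 → b ≥ 3 → (+ a) ≡ (+ 1) [mod 2 ] → (+ b) ≡ (+ 1) [mod 2 ] →
    n ≡ (+ 6) [mod 8 ] →
    ∀ (v : InvValue) → (v ∈I₂[ a , b , n ]) ⇔ (v ≡ inv½)
lemma3p8 a b n a≥3 b≥3 a-odd b-odd n≡6 v with odd-from-3 a≥3 a-odd | odd-from-3 b≥3 b-odd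
... | k , refl | l , refl =
  mk⇔ (only-½ (λ P → no-inv0 P (some-chart-obstructed mod⟨ n≡6 ⟩ k l P)))
      (λ { refl → point-½ mod⟨ n≡6 ⟩ k l })
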